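{- Let $M_1=(E_1,G_1)$, $M_2=(E_2,G_2)$ be matroids, let $F_1,F_2$ be flats of $G_1,G_2$ respectively, and let $M=(E,G_1\oplus G_2)$ with $E=(E_1\cup E_2)\cup(F_1+(E_2\cap F_2))$ (a partial lift-join). Then $\omega(M)\le\omega(M_1)+\omega(M_2)$ and $\sigma(M)\le\max(3,2(\sigma(M_1)+\sigma(M_2)))$.
   Context: A matroid is a pair $M=(E,G)$ where $G$ is the set of nonzero vectors of a finite-dimensional $\mathbb F_2$-vector space $V(G)=G\cup\{0\}$ and $E\subseteq G$. A flat of $G$ is a set $F\subseteq G$ with $F\cup\{0\}$ a subspace, of dimension that of the subspace. $G_1\oplus G_2$ is the set of nonzero vectors of $V(G_1)\oplus V(G_2)$, with each $V(G_i)$ identified with its copy; $X+Y=\{x+y:x\in X,y\in Y\}$. $M|F=(E\cap F,F)$. $I_\ell$ is the matroid $(B,G)$ with $\dim G=\ell$ and $B$ a basis of $V(G)$. $\omega(M)$ is the largest dimension of a flat contained in $E$, and $\sigma(M)$ is the largest $\ell$ such that some induced restriction $M|F$ is isomorphic (via a linear isomorphism) to $I_\ell$. -}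

module Defs where

open import Data.Nat using (ℕ; _≤_; _+_)
open import Data.Bool using (Bool; true; false; _xor_)
open import Data.Vec using (Vec; []; _∷_; replicate; zipWith; _++_)
open import Data.Vec.Membership.Propositional using (_∈_)
open import Data.Product using (Σ; ∃; _×_; _,_)
open import Data.Sum using (_⊎_)
open import Relation.Binary.PropositionalEquality using (_≡_; _≢_)
open import Relation.Nullary using (¬_)
open import Function.Bundles using (_⇔_)
open import Level using (0ℓ) renaming (suc to lsuc)

Vtr : ℕ → Set
Vtr n = Vec Bool n

𝟎 : ∀ {n} → Vtr n
𝟎 {n} = replicate n false

_⊕_ : ∀ {n} → Vtr n → Vtr n → Vtr n
_⊕_ = zipWith _xor_

-- A subset of V (subsets of G are those not containing 0).
VSet : ℕ → Set₁
VSet n = Vtr n → Set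

IsMatroid : ∀ n → VSet n → Set
IsMatroid n E = ∀ v → E v → v ≢ 𝟎

_∪𝟎 : ∀ {n} → VSet n → VSet n
(F ∪𝟎) v = F v ⊎ v ≡ 𝟎

-- F is a flat: F ⊆ G and F ∪ {0} is a subspace (over F₂: closed under +).
IsFlat : ∀ n → VSet n → Set
IsFlat n F = (∀ v → F v → v ≢ 𝟎)
           × (∀ u v → (F ∪𝟎) u → (F ∪𝟎) v → (F ∪𝟎) (u ⊕ v))

lincomb : ∀ {n d} → Vec Bool d → Vec (Vtr n) d → Vtr n
lincomb [] [] = 𝟎
lincomb (true ∷ c) (b ∷ bs) = b ⊕ lincomb c bs
lincomb (false ∷ c) (b ∷ bs) = lincomb c bs

LinIndep : ∀ {n d} → Vec (Vtr n) d → Set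
LinIndep {d = d} bs = ∀ c → lincomb c bs ≡ 𝟎 → c ≡ replicate d false

IsBasisOf : ∀ {n d} → Vec (Vtr n) d → VSet n → Set
IsBasisOf bs S = LinIndep bs × (∀ v → S v ⇔ ∃ λ c → lincomb c bs ≡ v)

HasDim : ∀ {n} → VSet n → ℕ → Set
HasDim {n} F d = ∃ λ (bs : Vec (Vtr n) d) → IsBasisOf bs (F ∪𝟎)

_⊆_ : ∀ {n} → VSet n → VSet n → Set
F ⊆ E = ∀ v → F v → E v

HasFlatOfDim : ∀ n → VSet n → ℕ → Set₁
HasFlatOfDim n E k = Σ (VSet n) λ F → IsFlat n F × F ⊆ E × HasDim F k

IsOmega : ∀ n → VSet n → ℕ → Set₁
IsOmega n E k = HasFlatOfDim n E k × (∀ d → HasFlatOfDim n E d → d ≤ k)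

Linear : ∀ {ℓ n} → (Vtr ℓ → Vtr n) → Set
Linear φ = ∀ x y → φ (x ⊕ y) ≡ φ x ⊕ φ y

Injective : ∀ {ℓ n} → (Vtr ℓ → Vtr n) → Set
Injective φ = ∀ x y → φ x ≡ φ y → x ≡ y

-- M|F = (E ∩ F, F) is isomorphic to I_ℓ = (B, F₂^ℓ ∖ {0}) with B a basis of F₂^ℓ,
-- via a linear isomorphism φ : F₂^ℓ → F ∪ {0} carrying B onto E ∩ F.
RestrIsoI : ∀ n → VSet n → VSet n → ℕ → Set
RestrIsoI n E F ℓ =
  Σ (Vtr ℓ → Vtr n) λ φ →
    Linear φ × Injective φ × (∀ v → (F ∪𝟎) v ⇔ ∃ λ x → φ x ≡ v) ×
    Σ (Vec (Vtr ℓ) ℓ) λ B →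
      IsBasisOf B (λ _ → Data.Unit.⊤) ×
      (∀ x → (x ∈ B) ⇔ (E (φ x) × F (φ x)))
  where import Data.Unit

HasIRestr : ∀ n → VSet n → ℕ → Set₁
HasIRestr n E ℓ = Σ (VSet n) λ F → IsFlat n F × RestrIsoI n E F ℓ

IsSigma : ∀ n → VSet n → ℕ → Set₁
IsSigma n E ℓ = HasIRestr n E ℓ × (∀ d → HasIRestr n E d → d ≤ ℓ)

-- Partial lift-join ground set in V(G₁) ⊕ V(G₂) = F₂^(n₁+n₂):
-- E = (E₁ ∪ E₂) ∪ (F₁ + (E₂ ∩ F₂)), V(Gᵢ) identified with its copy.
LiftJoin : ∀ {n₁ n₂} → VSet n₁ → VSet n₂ → VSet n₁ → VSet n₂ → VSet (n₁ + n₂)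
LiftJoin {n₁} {n₂} E₁ E₂ F₁ F₂ w =
  Σ (Vtr n₁) λ u → Σ (Vtr n₂) λ v → w ≡ u ++ v ×
    ((E₁ u × v ≡ 𝟎) ⊎ (u ≡ 𝟎 × E₂ v) ⊎ (F₁ u × (E₂ v × F₂ v)))

{-# OPTIONS --safe #-}
-- A flat W ⊆ E splits, by rank–nullity for the projection onto V(G₂), into its kernel, which lies
-- in V(G₁) and hence in E₁, and its image, whose nonzero vectors lie in E₂; so ω(M) ≤ ω(M₁) + ω(M₂).
-- An induced I_σ in M has a basis of elements of E of three kinds: in E₁, in E₂, or in
-- F₁ + (E₂ ∩ F₂). The first two kinds span induced I's of M₁ and M₂. A combination of the third kind
-- whose tail lies in E₂ is itself in E (its head lies in F₁ ∪ 0), so the tails meet E₂ exactly in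
-- the single tails. Such a family is either independent, giving another induced I of M₂, or
-- repeats a tail, and then it has at most two members. Hence σ ≤ σ₁ + 2σ₂, or σ ≤ σ₁ + σ₂ + 2
-- with σ₂ ≥ 1.
module Submission where

open import Defs
open import Data.Nat using (ℕ; zero; suc; _≤_; _<_; _+_; _*_; _⊔_; z≤n; s≤s; _≤?_)
open import Data.Nat.Properties
  using (≤-trans; ≤-refl; +-mono-≤; +-monoʳ-≤; +-suc; m≤n⊔m; m≤m+n; m≤n+m; ≰⇒>; suc-injective; 1+n≢0;
         module ≤-Reasoning)
open import Data.Bool as Bool using (Bool; true; false; _xor_)
open import Data.Bool.Properties using (xor-assoc; xor-comm; xor-same; xor-identityˡ; xor-identityʳ)
open import Data.Vec using (Vec; []; _∷_; zipWith; _++_; map; take; drop)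
open import Data.Vec.Properties
  using (zipWith-assoc; zipWith-comm; zipWith-identityˡ; zipWith-identityʳ; zipWith-++;
         take-zipWith; drop-zipWith; take++drop≡id; ++-injective; ∷-injectiveʳ; ≡-dec)
open import Data.Vec.Membership.Propositional using (_∈_)
open import Data.Vec.Relation.Unary.Any using (here; there)
open import Data.Vec.Relation.Unary.All as All using (All; []; _∷_)
open import Data.Product using (∃; _×_; _,_; proj₁; proj₂; map₂)
open import Data.Sum as Sum using (_⊎_; inj₁; inj₂)
open import Data.Empty using (⊥-elim)
open import Data.Unit using (tt)
open import Relation.Binary.PropositionalEquality
  using (_≡_; _≢_; refl; sym; trans; cong; cong₂; subst; module ≡-Reasoning)
open import Relation.Nullary using (¬_; Dec; yes; no)
open import Relation.Nullary.Decidable using (map′; _⊎-dec_)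
open import Function using (_∘_)
open import Function.Bundles using (_⇔_; mk⇔; Equivalence)
open import Function.Properties.Equivalence using () renaming (trans to ⇔-trans; sym to ⇔-sym)

open Equivalence using (to; from)

private
  variable
    n m d k : ℕ

⊕-assoc : (x y z : Vtr n) → (x ⊕ y) ⊕ z ≡ x ⊕ (y ⊕ z)
⊕-assoc = zipWith-assoc xor-assoc

⊕-comm : (x y : Vtr n) → x ⊕ y ≡ y ⊕ x
⊕-comm = zipWith-comm xor-comm

⊕-identityˡ : (x : Vtr n) → 𝟎 ⊕ x ≡ x
⊕-identityˡ = zipWith-identityˡ xor-identityˡ

⊕-identityʳ : (x : Vtr n) → x ⊕ 𝟎 ≡ x
⊕-identityʳ = zipWith-identityʳ xor-identityʳ

⊕-self : (x : Vtr n) → x ⊕ x ≡ 𝟎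
⊕-self []      = refl
⊕-self (a ∷ x) = cong₂ _∷_ (xor-same a) (⊕-self x)

⊕-cancelʳ : (x y : Vtr n) → (x ⊕ y) ⊕ y ≡ x
⊕-cancelʳ x y = trans (⊕-assoc x y y) (trans (cong (x ⊕_) (⊕-self y)) (⊕-identityʳ x))

⊕≡𝟎⇒≡ : (x y : Vtr n) → x ⊕ y ≡ 𝟎 → x ≡ y
⊕≡𝟎⇒≡ x y x⊕y≡𝟎 = trans (sym (⊕-cancelʳ x y)) (trans (cong (_⊕ y) x⊕y≡𝟎) (⊕-identityˡ y))

≡⇒⊕≡𝟎 : {x y : Vtr n} → x ≡ y → x ⊕ y ≡ 𝟎
≡⇒⊕≡𝟎 {x = x} refl = ⊕-self x

⊕-interchange : (a b c e : Vtr n) → (a ⊕ b) ⊕ (c ⊕ e) ≡ (a ⊕ c) ⊕ (b ⊕ e)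
⊕-interchange a b c e = begin
  (a ⊕ b) ⊕ (c ⊕ e)  ≡⟨ ⊕-assoc a b (c ⊕ e) ⟩
  a ⊕ (b ⊕ (c ⊕ e))  ≡⟨ cong (a ⊕_) (sym (⊕-assoc b c e)) ⟩
  a ⊕ ((b ⊕ c) ⊕ e)  ≡⟨ cong (λ z → a ⊕ (z ⊕ e)) (⊕-comm b c) ⟩
  a ⊕ ((c ⊕ b) ⊕ e)  ≡⟨ cong (a ⊕_) (⊕-assoc c b e) ⟩
  a ⊕ (c ⊕ (b ⊕ e))  ≡⟨ sym (⊕-assoc a c (b ⊕ e)) ⟩
  (a ⊕ c) ⊕ (b ⊕ e)  ∎
  where open ≡-Reasoning

𝟎++𝟎 : ∀ m → 𝟎 {m} ++ 𝟎 {n} ≡ 𝟎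
𝟎++𝟎 zero    = refl
𝟎++𝟎 (suc m) = cong (false ∷_) (𝟎++𝟎 m)

++-⊕ : (u u′ : Vtr m) (v v′ : Vtr n) → (u ++ v) ⊕ (u′ ++ v′) ≡ (u ⊕ u′) ++ (v ⊕ v′)
++-⊕ u u′ v v′ = zipWith-++ _xor_ u v u′ v′

linear-𝟎 : {φ : Vtr m → Vtr n} → Linear φ → φ 𝟎 ≡ 𝟎
linear-𝟎 {φ = φ} lin = begin
  φ 𝟎            ≡⟨ cong φ (sym (⊕-self 𝟎)) ⟩
  φ (𝟎 ⊕ 𝟎)      ≡⟨ lin 𝟎 𝟎 ⟩
  φ 𝟎 ⊕ φ 𝟎      ≡⟨ ⊕-self (φ 𝟎) ⟩
  𝟎              ∎
  where open ≡-Reasoning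

linear-injective-𝟎 : {φ : Vtr m → Vtr n} → Linear φ → Injective φ → ∀ x → φ x ≡ 𝟎 → x ≡ 𝟎
linear-injective-𝟎 lin inj x φx≡𝟎 = inj x 𝟎 (trans φx≡𝟎 (sym (linear-𝟎 lin)))

take-linear : Linear (take m {n})
take-linear = take-zipWith _xor_

drop-linear : Linear (drop m {n})
drop-linear = drop-zipWith _xor_

ι₁ : Vtr m → Vtr (m + n)
ι₁ u = u ++ 𝟎

ι₂ : Vtr n → Vtr (m + n)
ι₂ {m = m} v = 𝟎 {m} ++ v

ι₁-linear : Linear (ι₁ {m} {n})
ι₁-linear u u′ = trans (cong ((u ⊕ u′) ++_) (sym (⊕-self 𝟎))) (sym (++-⊕ u u′ 𝟎 𝟎))

ι₂-linear : Linear (ι₂ {n} {m})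
ι₂-linear v v′ = trans (cong (_++ (v ⊕ v′)) (sym (⊕-self 𝟎))) (sym (++-⊕ 𝟎 𝟎 v v′))

ι₁-injective : Injective (ι₁ {m} {n})
ι₁-injective u u′ eq = proj₁ (++-injective u u′ eq)

ι₂-injective : Injective (ι₂ {n} {m})
ι₂-injective v v′ eq = proj₂ (++-injective 𝟎 𝟎 eq)

lincomb-𝟎 : (xs : Vec (Vtr n) d) → lincomb 𝟎 xs ≡ 𝟎
lincomb-𝟎 []       = refl
lincomb-𝟎 (x ∷ xs) = lincomb-𝟎 xs

lincomb-⊕ : (c c′ : Vtr d) (xs : Vec (Vtr n) d) →
            lincomb (c ⊕ c′) xs ≡ lincomb c xs ⊕ lincomb c′ xs
lincomb-⊕ []          []           []       = sym (⊕-self 𝟎)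
lincomb-⊕ (true ∷ c)  (true ∷ c′)  (x ∷ xs) = begin
  lincomb (c ⊕ c′) xs                          ≡⟨ lincomb-⊕ c c′ xs ⟩
  lincomb c xs ⊕ lincomb c′ xs                 ≡⟨ sym (⊕-identityˡ _) ⟩
  𝟎 ⊕ (lincomb c xs ⊕ lincomb c′ xs)           ≡⟨ cong (_⊕ _) (sym (⊕-self x)) ⟩
  (x ⊕ x) ⊕ (lincomb c xs ⊕ lincomb c′ xs)     ≡⟨ ⊕-interchange x x _ _ ⟩
  (x ⊕ lincomb c xs) ⊕ (x ⊕ lincomb c′ xs)     ∎
  where open ≡-Reasoning
lincomb-⊕ (true ∷ c)  (false ∷ c′) (x ∷ xs) =
  trans (cong (x ⊕_) (lincomb-⊕ c c′ xs)) (sym (⊕-assoc x _ _))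
lincomb-⊕ (false ∷ c) (true ∷ c′)  (x ∷ xs) = begin
  x ⊕ lincomb (c ⊕ c′) xs                ≡⟨ cong (x ⊕_) (lincomb-⊕ c c′ xs) ⟩
  x ⊕ (lincomb c xs ⊕ lincomb c′ xs)     ≡⟨ sym (⊕-assoc x _ _) ⟩
  (x ⊕ lincomb c xs) ⊕ lincomb c′ xs     ≡⟨ cong (_⊕ lincomb c′ xs) (⊕-comm x _) ⟩
  (lincomb c xs ⊕ x) ⊕ lincomb c′ xs     ≡⟨ ⊕-assoc _ x _ ⟩
  lincomb c xs ⊕ (x ⊕ lincomb c′ xs)     ∎
  where open ≡-Reasoning
lincomb-⊕ (false ∷ c) (false ∷ c′) (x ∷ xs) = lincomb-⊕ c c′ xs

lincomb-map : {f : Vtr m → Vtr n} → Linear f → (c : Vtr d) (xs : Vec (Vtr m) d) →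
              lincomb c (map f xs) ≡ f (lincomb c xs)
lincomb-map lin []          []       = sym (linear-𝟎 lin)
lincomb-map lin (true ∷ c)  (x ∷ xs) = trans (cong (_ ⊕_) (lincomb-map lin c xs)) (sym (lin x _))
lincomb-map lin (false ∷ c) (x ∷ xs) = lincomb-map lin c xs

lincomb-++ : (c : Vtr d) (us : Vec (Vtr m) d) (vs : Vec (Vtr n) d) →
             lincomb c (zipWith _++_ us vs) ≡ lincomb c us ++ lincomb c vs
lincomb-++ {m = m} []     []       []       = sym (𝟎++𝟎 m)
lincomb-++ (true ∷ c)  (u ∷ us) (v ∷ vs) =
  trans (cong ((u ++ v) ⊕_) (lincomb-++ c us vs)) (++-⊕ u _ v _)
lincomb-++ (false ∷ c) (u ∷ us) (v ∷ vs) = lincomb-++ c us vs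

Span : Vec (Vtr n) d → VSet n
Span xs v = ∃ λ c → lincomb c xs ≡ v

Span-here : (x : Vtr n) (xs : Vec (Vtr n) d) → Span (x ∷ xs) x
Span-here x xs = (true ∷ 𝟎) , trans (cong (x ⊕_) (lincomb-𝟎 xs)) (⊕-identityʳ x)

Span-there : (x : Vtr n) {xs : Vec (Vtr n) d} {v : Vtr n} → Span xs v → Span (x ∷ xs) v
Span-there x (c , eq) = (false ∷ c) , eq

Span-⊕ : {xs : Vec (Vtr n) d} {u v : Vtr n} → Span xs u → Span xs v → Span xs (u ⊕ v)
Span-⊕ {xs = xs} (c , refl) (c′ , refl) = (c ⊕ c′) , lincomb-⊕ c c′ xs

_⊆Span_ : Vec (Vtr n) k → Vec (Vtr n) d → Set
ys ⊆Span xs = ∀ c → Span xs (lincomb c ys)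

⊆Span-∷ : {y : Vtr n} {ys : Vec (Vtr n) k} {xs : Vec (Vtr n) d} →
          Span xs y → ys ⊆Span xs → (y ∷ ys) ⊆Span xs
⊆Span-∷ y∈ ys⊆ (true ∷ c)  = Span-⊕ y∈ (ys⊆ c)
⊆Span-∷ y∈ ys⊆ (false ∷ c) = ys⊆ c

⊆Span-there : (x : Vtr n) {ys : Vec (Vtr n) k} {xs : Vec (Vtr n) d} →
              ys ⊆Span xs → ys ⊆Span (x ∷ xs)
⊆Span-there x ys⊆ c = Span-there x (ys⊆ c)

LinIndep-tail : {x : Vtr n} {xs : Vec (Vtr n) d} → LinIndep (x ∷ xs) → LinIndep xs
LinIndep-tail indep c eq = ∷-injectiveʳ (indep (false ∷ c) eq)

LinIndep-head∉Span : {x : Vtr n} {xs : Vec (Vtr n) d} → LinIndep (x ∷ xs) → ¬ Span xs x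
LinIndep-head∉Span indep (c , eq) with indep (true ∷ c) (≡⇒⊕≡𝟎 (sym eq))
... | ()

LinIndep-∷ : {x : Vtr n} {xs : Vec (Vtr n) d} → LinIndep xs → ¬ Span xs x → LinIndep (x ∷ xs)
LinIndep-∷ indep x∉ (true ∷ c)  eq = ⊥-elim (x∉ (c , sym (⊕≡𝟎⇒≡ _ _ eq)))
LinIndep-∷ indep x∉ (false ∷ c) eq = cong (false ∷_) (indep c eq)

lincomb-injective : {xs : Vec (Vtr n) d} → LinIndep xs → ∀ c c′ → lincomb c xs ≡ lincomb c′ xs → c ≡ c′
lincomb-injective {xs = xs} indep c c′ eq =
  ⊕≡𝟎⇒≡ c c′ (indep (c ⊕ c′) (trans (lincomb-⊕ c c′ xs) (≡⇒⊕≡𝟎 eq)))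

∃? : {P : Vtr d → Set} → (∀ c → Dec (P c)) → Dec (∃ P)
∃? {zero}  P? = map′ ([] ,_) (λ { ([] , p) → p }) (P? [])
∃? {suc d} {P} P? = map′ join split (∃? (λ c → P? (true ∷ c)) ⊎-dec ∃? (λ c → P? (false ∷ c)))
  where
  Halves : Set
  Halves = ∃ (λ c → P (true ∷ c)) ⊎ ∃ (λ c → P (false ∷ c))
  join : Halves → ∃ P
  join (inj₁ (c , p)) = true ∷ c , p
  join (inj₂ (c , p)) = false ∷ c , p
  split : ∃ P → Halves
  split (true ∷ c , p)  = inj₁ (c , p)
  split (false ∷ c , p) = inj₂ (c , p)

Span? : (xs : Vec (Vtr n) d) (v : Vtr n) → Dec (Span xs v)
Span? xs v = ∃? (λ c → ≡-dec Bool._≟_ (lincomb c xs) v)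

-- Rank–nullity

record KernelImageSplit (f : Vtr m → Vtr n) (ws : Vec (Vtr m) d) : Set where
  field
    nullity rank   : ℕ
    nullity+rank   : nullity + rank ≡ d
    kernelBasis    : Vec (Vtr m) nullity
    imageLift      : Vec (Vtr m) rank
    kernelBasis-indep  : LinIndep kernelBasis
    image-indep        : LinIndep (map f imageLift)
    kernelBasis-⊆ker   : ∀ c → f (lincomb c kernelBasis) ≡ 𝟎
    kernelBasis-⊆Span  : kernelBasis ⊆Span ws
    imageLift-⊆Span    : imageLift ⊆Span ws

module _ {f : Vtr m → Vtr n} (lin : Linear f) {w : Vtr m} {ws : Vec (Vtr m) d}
         (split : KernelImageSplit f ws) where
  open KernelImageSplit split

  KernelImageSplit-∷kernel : LinIndep (w ∷ ws) → Span (map f imageLift) (f w) →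
                             KernelImageSplit f (w ∷ ws)
  KernelImageSplit-∷kernel indep (c₀ , eq₀) = record
    { nullity = suc nullity ; rank = rank ; nullity+rank = cong suc nullity+rank
    ; kernelBasis = x ∷ kernelBasis ; imageLift = imageLift
    ; kernelBasis-indep = LinIndep-∷ kernelBasis-indep x∉
    ; image-indep = image-indep
    ; kernelBasis-⊆ker = ⊆ker
    ; kernelBasis-⊆Span = ⊆Span-∷ x∈ (⊆Span-there w kernelBasis-⊆Span)
    ; imageLift-⊆Span = ⊆Span-there w imageLift-⊆Span }
    where
    x : Vtr m
    x = w ⊕ lincomb c₀ imageLift
    fx≡𝟎 : f x ≡ 𝟎
    fx≡𝟎 = begin
      f (w ⊕ lincomb c₀ imageLift)           ≡⟨ lin w _ ⟩
      f w ⊕ f (lincomb c₀ imageLift)         ≡⟨ cong (f w ⊕_) (sym (lincomb-map lin c₀ imageLift)) ⟩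
      f w ⊕ lincomb c₀ (map f imageLift)     ≡⟨ ≡⇒⊕≡𝟎 (sym eq₀) ⟩
      𝟎                                      ∎
      where open ≡-Reasoning
    ⊆ker : ∀ c → f (lincomb c (x ∷ kernelBasis)) ≡ 𝟎
    ⊆ker (true ∷ c)  = trans (lin x _) (trans (cong₂ _⊕_ fx≡𝟎 (kernelBasis-⊆ker c)) (⊕-self 𝟎))
    ⊆ker (false ∷ c) = kernelBasis-⊆ker c
    x∈ : Span (w ∷ ws) x
    x∈ = Span-⊕ (Span-here w ws) (Span-there w (imageLift-⊆Span c₀))
    x∉ : ¬ Span kernelBasis x
    x∉ (c , eq) = LinIndep-head∉Span indep
      (subst (Span ws) (⊕-cancelʳ w _)
        (Span-⊕ (subst (Span ws) eq (kernelBasis-⊆Span c)) (imageLift-⊆Span c₀)))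

  KernelImageSplit-∷image : ¬ Span (map f imageLift) (f w) → KernelImageSplit f (w ∷ ws)
  KernelImageSplit-∷image fw∉ = record
    { nullity = nullity ; rank = suc rank
    ; nullity+rank = trans (+-suc nullity rank) (cong suc nullity+rank)
    ; kernelBasis = kernelBasis ; imageLift = w ∷ imageLift
    ; kernelBasis-indep = kernelBasis-indep
    ; image-indep = LinIndep-∷ image-indep fw∉
    ; kernelBasis-⊆ker = kernelBasis-⊆ker
    ; kernelBasis-⊆Span = ⊆Span-there w kernelBasis-⊆Span
    ; imageLift-⊆Span = ⊆Span-∷ (Span-here w ws) (⊆Span-there w imageLift-⊆Span) }

-- Gaussian elimination: each new vector either enlarges the image or,
-- corrected by a combination of earlier lifts, becomes a new kernel vector.
kernelImageSplit : {f : Vtr m → Vtr n} → Linear f →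
                   (ws : Vec (Vtr m) d) → LinIndep ws → KernelImageSplit f ws
kernelImageSplit lin [] _ = record
  { nullity = 0 ; rank = 0 ; nullity+rank = refl ; kernelBasis = [] ; imageLift = []
  ; kernelBasis-indep = λ { [] _ → refl } ; image-indep = λ { [] _ → refl }
  ; kernelBasis-⊆ker = λ { [] → linear-𝟎 lin }
  ; kernelBasis-⊆Span = λ { [] → [] , refl } ; imageLift-⊆Span = λ { [] → [] , refl } }
kernelImageSplit {f = f} lin (w ∷ ws) indep
  with kernelImageSplit lin ws (LinIndep-tail indep)
... | split with Span? (map f (KernelImageSplit.imageLift split)) (f w)
...   | yes fw∈ = KernelImageSplit-∷kernel lin split indep fw∈
...   | no fw∉  = KernelImageSplit-∷image lin split fw∉

NonzeroSpan : Vec (Vtr n) d → VSet n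
NonzeroSpan xs v = Span xs v × v ≢ 𝟎

NonzeroSpan-∪𝟎 : (xs : Vec (Vtr n) d) (v : Vtr n) → (NonzeroSpan xs ∪𝟎) v ⇔ Span xs v
NonzeroSpan-∪𝟎 xs v = mk⇔ forget restore
  where
  forget : (NonzeroSpan xs ∪𝟎) v → Span xs v
  forget (inj₁ (v∈ , _)) = v∈
  forget (inj₂ refl)     = 𝟎 , lincomb-𝟎 xs
  restore : Span xs v → (NonzeroSpan xs ∪𝟎) v
  restore v∈ with ≡-dec Bool._≟_ v 𝟎
  ... | yes v≡𝟎 = inj₂ v≡𝟎
  ... | no v≢𝟎  = inj₁ (v∈ , v≢𝟎)

NonzeroSpan-isFlat : (xs : Vec (Vtr n) d) → IsFlat n (NonzeroSpan xs)
NonzeroSpan-isFlat xs = (λ _ → proj₂) , closed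
  where
  closed : ∀ u v → (NonzeroSpan xs ∪𝟎) u → (NonzeroSpan xs ∪𝟎) v → (NonzeroSpan xs ∪𝟎) (u ⊕ v)
  closed u v u∈ v∈ = from (NonzeroSpan-∪𝟎 xs (u ⊕ v))
    (Span-⊕ (to (NonzeroSpan-∪𝟎 xs u) u∈) (to (NonzeroSpan-∪𝟎 xs v) v∈))

LinIndep⇒HasFlatOfDim : {E : VSet n} {xs : Vec (Vtr n) d} →
                        LinIndep xs → NonzeroSpan xs ⊆ E → HasFlatOfDim n E d
LinIndep⇒HasFlatOfDim {xs = xs} indep ⊆E =
  NonzeroSpan xs , NonzeroSpan-isFlat xs , ⊆E , xs , indep , NonzeroSpan-∪𝟎 xs

basis-NonzeroSpan-⊆ : {E F : VSet n} {bs : Vec (Vtr n) d} →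
                      F ⊆ E → IsBasisOf bs (F ∪𝟎) → NonzeroSpan bs ⊆ E
basis-NonzeroSpan-⊆ F⊆E (_ , spans) v (v∈ , v≢𝟎) with from (spans v) v∈
... | inj₁ v∈F = F⊆E v v∈F
... | inj₂ v≡𝟎 = ⊥-elim (v≢𝟎 v≡𝟎)

IsFlat-lincomb : {F : VSet n} → IsFlat n F → {xs : Vec (Vtr n) d} → All F xs →
                 ∀ c → (F ∪𝟎) (lincomb c xs)
IsFlat-lincomb flat []         []          = inj₂ refl
IsFlat-lincomb flat (x∈ ∷ xs∈) (true ∷ c)  = proj₂ flat _ _ (inj₁ x∈) (IsFlat-lincomb flat xs∈ c)
IsFlat-lincomb flat (x∈ ∷ xs∈) (false ∷ c) = IsFlat-lincomb flat xs∈ c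

weight : Vtr n → ℕ
weight []          = 0
weight (true ∷ c)  = suc (weight c)
weight (false ∷ c) = weight c

IsUnit : Vtr n → Set
IsUnit c = weight c ≡ 1

weight-𝟎 : ∀ n → weight (𝟎 {n}) ≡ 0
weight-𝟎 zero    = refl
weight-𝟎 (suc n) = weight-𝟎 n

weight≡0⇒≡𝟎 : (c : Vtr n) → weight c ≡ 0 → c ≡ 𝟎
weight≡0⇒≡𝟎 []          _  = refl
weight≡0⇒≡𝟎 (false ∷ c) w≡0 = cong (false ∷_) (weight≡0⇒≡𝟎 c w≡0)

IsUnit-head : ∀ n → IsUnit (true ∷ 𝟎 {n})
IsUnit-head n = cong suc (weight-𝟎 n)

IsUnit-split : (c : Vtr n) {j : ℕ} → weight c ≡ suc j →
               ∃ λ u → ∃ λ c′ → IsUnit u × weight c′ ≡ j × c ≡ u ⊕ c′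
IsUnit-split {suc n} (true ∷ c) w≡ =
  true ∷ 𝟎 , false ∷ c , IsUnit-head n , suc-injective w≡ , cong (true ∷_) (sym (⊕-identityˡ c))
IsUnit-split (false ∷ c) w≡ with IsUnit-split c w≡
... | u , c′ , u-unit , w′ , c≡ = false ∷ u , false ∷ c′ , u-unit , w′ , cong (false ∷_) c≡

IsUnit-extend : (c : Vtr n) → weight c < n → ∃ λ u → IsUnit u × weight (c ⊕ u) ≡ suc (weight c)
IsUnit-extend {suc n} (false ∷ c) _ =
  true ∷ 𝟎 , IsUnit-head n , cong (suc ∘ weight) (⊕-identityʳ c)
IsUnit-extend (true ∷ c) (s≤s w<n) with IsUnit-extend c w<n
... | u , u-unit , w≡ = false ∷ u , u-unit , cong suc w≡

lincomb-unit-∈ : (xs : Vec (Vtr n) d) (c : Vtr d) → IsUnit c → lincomb c xs ∈ xs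
lincomb-unit-∈ (x ∷ xs) (true ∷ c) c-unit =
  here (trans (cong (λ c′ → x ⊕ lincomb c′ xs) (weight≡0⇒≡𝟎 c (suc-injective c-unit)))
              (trans (cong (x ⊕_) (lincomb-𝟎 xs)) (⊕-identityʳ x)))
lincomb-unit-∈ (x ∷ xs) (false ∷ c) c-unit = there (lincomb-unit-∈ xs c c-unit)

∈⇒lincomb-unit : {x : Vtr n} {xs : Vec (Vtr n) d} → x ∈ xs → ∃ λ u → IsUnit u × lincomb u xs ≡ x
∈⇒lincomb-unit {d = suc d} {xs = y ∷ xs} (here refl) = true ∷ 𝟎 , IsUnit-head d , proj₂ (Span-here y xs)
∈⇒lincomb-unit (there x∈) with ∈⇒lincomb-unit x∈
... | u , u-unit , eq = false ∷ u , u-unit , eq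

lincomb-∈⇔IsUnit : {xs : Vec (Vtr n) d} → LinIndep xs → ∀ c → lincomb c xs ∈ xs ⇔ IsUnit c
lincomb-∈⇔IsUnit {xs = xs} indep c = mk⇔ unit (lincomb-unit-∈ xs c)
  where
  unit : lincomb c xs ∈ xs → IsUnit c
  unit c∈ with ∈⇒lincomb-unit c∈
  ... | u , u-unit , eq = subst IsUnit (lincomb-injective indep u c eq) u-unit

units : ∀ d → Vec (Vtr d) d
units zero    = []
units (suc d) = (true ∷ 𝟎) ∷ map (false ∷_) (units d)

lincomb-units : (c : Vtr d) → lincomb c (units d) ≡ c
lincomb-units {zero}  []          = refl
lincomb-units {suc d} (true ∷ c)  = begin
  (true ∷ 𝟎) ⊕ lincomb c (map (false ∷_) (units d))
    ≡⟨ cong ((true ∷ 𝟎) ⊕_) (lincomb-map (λ _ _ → refl) c (units d)) ⟩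
  (true ∷ 𝟎) ⊕ (false ∷ lincomb c (units d))         ≡⟨ cong (true ∷_) (⊕-identityˡ _) ⟩
  true ∷ lincomb c (units d)                          ≡⟨ cong (true ∷_) (lincomb-units c) ⟩
  true ∷ c                                            ∎
  where open ≡-Reasoning
lincomb-units {suc d} (false ∷ c) =
  trans (lincomb-map (λ _ _ → refl) c (units d)) (cong (false ∷_) (lincomb-units c))

units-indep : LinIndep (units d)
units-indep c eq = trans (sym (lincomb-units c)) eq

∈units⇔IsUnit : (c : Vtr d) → c ∈ units d ⇔ IsUnit c
∈units⇔IsUnit c =
  subst (λ c′ → c′ ∈ units _ ⇔ IsUnit c) (lincomb-units c) (lincomb-∈⇔IsUnit units-indep c)

-- Families inducing I_d

record MeetsSpanInUnits (E : VSet n) (bs : Vec (Vtr n) d) : Set where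
  constructor meetsSpanInUnits
  field ∈⇔IsUnit : ∀ c → E (lincomb c bs) ⇔ IsUnit c

open MeetsSpanInUnits public

-- bs is a basis of a flat F with M|F ≅ I_d, the isomorphism sending unit vectors to bs.
record IsIFamily (E : VSet n) (bs : Vec (Vtr n) d) : Set where
  field
    independent : LinIndep bs
    meets       : MeetsSpanInUnits E bs

IsIFamily-map : {E′ : VSet n} {E : VSet m} {φ : Vtr m → Vtr n} → Linear φ → Injective φ →
                (∀ u → E′ (φ u) ⇔ E u) → (xs : Vec (Vtr m) d) →
                IsIFamily E′ (map φ xs) ⇔ IsIFamily E xs
IsIFamily-map {E′ = E′} {E} {φ} lin inj E′∘φ⇔E xs = mk⇔ pull push
  where
  lincomb-φ : ∀ c → lincomb c (map φ xs) ≡ φ (lincomb c xs)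
  lincomb-φ c = lincomb-map lin c xs
  E′⇔E : ∀ c → E′ (lincomb c (map φ xs)) ⇔ E (lincomb c xs)
  E′⇔E c = subst (λ v → E′ v ⇔ E (lincomb c xs)) (sym (lincomb-φ c)) (E′∘φ⇔E (lincomb c xs))
  pull : IsIFamily E′ (map φ xs) → IsIFamily E xs
  pull family = record
    { independent = λ c null → independent c (trans (lincomb-φ c) (trans (cong φ null) (linear-𝟎 lin)))
    ; meets = meetsSpanInUnits λ c → ⇔-trans (⇔-sym (E′⇔E c)) (∈⇔IsUnit meets c) }
    where open IsIFamily family
  push : IsIFamily E xs → IsIFamily E′ (map φ xs)
  push family = record
    { independent = λ c null →
        independent c (linear-injective-𝟎 lin inj _ (trans (sym (lincomb-φ c)) null))
    ; meets = meetsSpanInUnits λ c → ⇔-trans (E′⇔E c) (∈⇔IsUnit meets c) }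
    where open IsIFamily family

IsIFamily-singleton : {E : VSet n} {v : Vtr n} → IsMatroid n E → E v → IsIFamily E (v ∷ [])
IsIFamily-singleton {E = E} {v} matroid v∈E = record
  { independent = indep ; meets = meetsSpanInUnits λ c → mk⇔ (unit c) (member c) }
  where
  indep : LinIndep (v ∷ [])
  indep (true ∷ [])  null = ⊥-elim (matroid v v∈E (trans (sym (⊕-identityʳ v)) null))
  indep (false ∷ []) _    = refl
  unit : ∀ c → E (lincomb c (v ∷ [])) → IsUnit c
  unit (true ∷ [])  _   = refl
  unit (false ∷ []) 𝟎∈E = ⊥-elim (matroid 𝟎 𝟎∈E refl)
  member : ∀ c → IsUnit c → E (lincomb c (v ∷ []))
  member (true ∷ []) _ = subst E (sym (⊕-identityʳ v)) v∈E

IsIFamily⇒HasIRestr : {E : VSet n} {bs : Vec (Vtr n) d} → IsIFamily E bs → HasIRestr n E d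
IsIFamily⇒HasIRestr {n} {d} {E} {bs} family =
  NonzeroSpan bs , NonzeroSpan-isFlat bs ,
  φ , lin , inj , NonzeroSpan-∪𝟎 bs ,
  units d , (units-indep , λ c → mk⇔ (λ _ → c , lincomb-units c) (λ _ → tt)) , units-members
  where
  open IsIFamily family
  φ : Vtr d → Vtr n
  φ c = lincomb c bs
  lin : Linear φ
  lin c c′ = lincomb-⊕ c c′ bs
  inj : Injective φ
  inj = lincomb-injective independent
  units-members : ∀ c → (c ∈ units d) ⇔ (E (φ c) × NonzeroSpan bs (φ c))
  units-members c = mk⇔ member (from (∈units⇔IsUnit c) ∘ to (∈⇔IsUnit meets c) ∘ proj₁)
    where
    member : c ∈ units d → E (φ c) × NonzeroSpan bs (φ c)
    member c∈ = from (∈⇔IsUnit meets c) c-unit , (c , refl) , φc≢𝟎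
      where
      c-unit : IsUnit c
      c-unit = to (∈units⇔IsUnit c) c∈
      φc≢𝟎 : φ c ≢ 𝟎
      φc≢𝟎 φc≡𝟎 = 1+n≢0 (trans (sym c-unit) (trans (cong weight (independent c φc≡𝟎)) (weight-𝟎 d)))

HasIRestr⇒IsIFamily : {E : VSet n} → IsMatroid n E → HasIRestr n E d →
                      ∃ λ (bs : Vec (Vtr n) d) → IsIFamily E bs
HasIRestr⇒IsIFamily {d = d} {E = E} matroid
  (F , _ , φ , lin , inj , image , B , (B-indep , _) , B-members) =
  map φ B , from (IsIFamily-map lin inj E∘φ⇔Q B) B-family
  where
  Q : VSet d
  Q x = E (φ x) × F (φ x)
  E∘φ⇔Q : ∀ x → E (φ x) ⇔ Q x
  E∘φ⇔Q x = mk⇔ (λ φx∈E → φx∈E , φx∈F φx∈E) proj₁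
    where
    φx∈F : E (φ x) → F (φ x)
    φx∈F φx∈E with from (image (φ x)) (x , refl)
    ... | inj₁ φx∈F = φx∈F
    ... | inj₂ φx≡𝟎 = ⊥-elim (matroid (φ x) φx∈E φx≡𝟎)
  B-family : IsIFamily Q B
  B-family = record
    { independent = B-indep
    ; meets = meetsSpanInUnits λ c →
        ⇔-trans (⇔-sym (B-members (lincomb c B))) (lincomb-∈⇔IsUnit B-indep c) }

infix 4 _⊑_
data _⊑_ {A : Set} : Vec A k → Vec A d → Set where
  []   : [] ⊑ []
  skip : {y : A} {xs : Vec A k} {ys : Vec A d} → xs ⊑ ys → xs ⊑ y ∷ ys
  keep : {x : A} {xs : Vec A k} {ys : Vec A d} → xs ⊑ ys → x ∷ xs ⊑ x ∷ ys

⊑-lincomb : {xs : Vec (Vtr n) k} {ys : Vec (Vtr n) d} → xs ⊑ ys →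
            ∀ c → ∃ λ c′ → lincomb c′ ys ≡ lincomb c xs × weight c′ ≡ weight c
⊑-lincomb []         []          = [] , refl , refl
⊑-lincomb (skip xs⊑) c           with ⊑-lincomb xs⊑ c
... | c′ , eq , w≡ = false ∷ c′ , eq , w≡
⊑-lincomb (keep xs⊑) (true ∷ c)  with ⊑-lincomb xs⊑ c
... | c′ , eq , w≡ = true ∷ c′ , cong (_ ⊕_) eq , cong suc w≡
⊑-lincomb (keep xs⊑) (false ∷ c) with ⊑-lincomb xs⊑ c
... | c′ , eq , w≡ = false ∷ c′ , eq , w≡

IsIFamily-⊑ : {E : VSet n} {xs : Vec (Vtr n) k} {ys : Vec (Vtr n) d} →
              xs ⊑ ys → IsIFamily E ys → IsIFamily E xs
IsIFamily-⊑ {d = d} {E = E} {xs = xs} {ys = ys} xs⊑ys family = record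
  { independent = indep ; meets = meetsSpanInUnits xs-meets }
  where
  open IsIFamily family renaming (independent to ys-indep; meets to ys-meets)
  indep : LinIndep xs
  indep c null with ⊑-lincomb xs⊑ys c
  ... | c′ , eq , w≡ = weight≡0⇒≡𝟎 c
    (trans (sym w≡) (trans (cong weight (ys-indep c′ (trans eq null))) (weight-𝟎 d)))
  xs-meets : ∀ c → E (lincomb c xs) ⇔ IsUnit c
  xs-meets c with ⊑-lincomb xs⊑ys c
  ... | c′ , eq , w≡ =
    subst (λ v → E v ⇔ IsUnit c) eq (subst (λ w → E (lincomb c′ ys) ⇔ w ≡ 1) w≡ (∈⇔IsUnit ys-meets c′))

MeetsSpanInUnits-tail : {P : VSet n} {v : Vtr n} {vs : Vec (Vtr n) d} →
                        MeetsSpanInUnits P (v ∷ vs) → MeetsSpanInUnits P vs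
MeetsSpanInUnits-tail meets = meetsSpanInUnits λ c → ∈⇔IsUnit meets (false ∷ c)

MeetsSpanInUnits⇒All : {P : VSet n} {vs : Vec (Vtr n) d} → MeetsSpanInUnits P vs → All P vs
MeetsSpanInUnits⇒All {vs = []}     meets = []
MeetsSpanInUnits⇒All {d = suc d} {P} {v ∷ vs} meets =
  subst P (proj₂ (Span-here v vs)) (from (∈⇔IsUnit meets (true ∷ 𝟎)) (IsUnit-head d))
  ∷ MeetsSpanInUnits⇒All (MeetsSpanInUnits-tail meets)

MeetsSpanInUnits⇒IsMatroid : {P : VSet n} {vs : Vec (Vtr n) d} → MeetsSpanInUnits P vs → IsMatroid n P
MeetsSpanInUnits⇒IsMatroid {d = d} {P} {vs} meets v v∈P refl =
  1+n≢0 (trans (sym (to (∈⇔IsUnit meets 𝟎) (subst P (sym (lincomb-𝟎 vs)) v∈P))) (weight-𝟎 d))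

module _ {P : VSet n} {vs : Vec (Vtr n) d} (meets : MeetsSpanInUnits P vs) where

  -- Peeling a unit u off a null combination c leaves c′ with the value of u, which lies in P;
  -- so c′ is a unit too.
  MeetsSpanInUnits-null : ∀ c → lincomb c vs ≡ 𝟎 → c ≡ 𝟎 ⊎ weight c ≡ 2
  MeetsSpanInUnits-null c null with weight c in w≡
  ... | zero  = inj₁ (weight≡0⇒≡𝟎 c w≡)
  ... | suc j with IsUnit-split c w≡
  ...   | u , c′ , u-unit , c′-weight , c≡u⊕c′ = inj₂ (cong suc (trans (sym c′-weight) c′-unit))
    where
    u≐c′ : lincomb u vs ≡ lincomb c′ vs
    u≐c′ = ⊕≡𝟎⇒≡ _ _
      (trans (sym (lincomb-⊕ u c′ vs)) (trans (cong (λ z → lincomb z vs) (sym c≡u⊕c′)) null))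
    c′-unit : IsUnit c′
    c′-unit = to (∈⇔IsUnit meets c′) (subst P u≐c′ (from (∈⇔IsUnit meets u) u-unit))

  -- A repeated vector would combine with any third one into a member of weight 3.
  MeetsSpanInUnits⇒LinIndep⊎≤2 : LinIndep vs ⊎ d ≤ 2
  MeetsSpanInUnits⇒LinIndep⊎≤2 with d ≤? 2
  ... | yes d≤2 = inj₂ d≤2
  ... | no d≰2  = inj₁ indep
    where
    indep : LinIndep vs
    indep c null with MeetsSpanInUnits-null c null
    ... | inj₁ c≡𝟎 = c≡𝟎
    ... | inj₂ w≡2 with IsUnit-extend c (subst (_< d) (sym w≡2) (≰⇒> d≰2))
    ...   | u , u-unit , w≡3 =
      ⊥-elim (1+n≢0 (sym (suc-injective (trans (sym c⊕u-unit) (trans w≡3 (cong suc w≡2))))))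
      where
      u≐c⊕u : lincomb u vs ≡ lincomb (c ⊕ u) vs
      u≐c⊕u = sym (trans (lincomb-⊕ c u vs) (trans (cong (_⊕ lincomb u vs) null) (⊕-identityˡ _)))
      c⊕u-unit : IsUnit (c ⊕ u)
      c⊕u-unit = to (∈⇔IsUnit meets (c ⊕ u)) (subst P u≐c⊕u (from (∈⇔IsUnit meets u) u-unit))

MeetsSpanInUnits⇒HasIRestr⊎≤2 : {P : VSet n} {vs : Vec (Vtr n) d} → MeetsSpanInUnits P vs →
                                HasIRestr n P d ⊎ (d ≤ 2 × HasIRestr n P 1)
MeetsSpanInUnits⇒HasIRestr⊎≤2 {vs = []} meets =
  inj₁ (IsIFamily⇒HasIRestr record { independent = λ { [] _ → refl } ; meets = meets })
MeetsSpanInUnits⇒HasIRestr⊎≤2 {vs = _ ∷ _} meets with MeetsSpanInUnits⇒LinIndep⊎≤2 meets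
... | inj₁ indep = inj₁ (IsIFamily⇒HasIRestr record { independent = indep ; meets = meets })
... | inj₂ d≤2   = inj₂ (d≤2 , IsIFamily⇒HasIRestr
                       (IsIFamily-singleton (MeetsSpanInUnits⇒IsMatroid meets)
                                            (All.head (MeetsSpanInUnits⇒All meets))))

-- The lift-join

module LiftJoinProperties {n₁ n₂ : ℕ} {E₁ F₁ : VSet n₁} {E₂ F₂ : VSet n₂}
                          (matroid₁ : IsMatroid n₁ E₁) (matroid₂ : IsMatroid n₂ E₂) where

  E : VSet (n₁ + n₂)
  E = LiftJoin E₁ E₂ F₁ F₂

  LiftJoin-++ : {u : Vtr n₁} {v : Vtr n₂} → E (u ++ v) →
                (E₁ u × v ≡ 𝟎) ⊎ (u ≡ 𝟎 × E₂ v) ⊎ (F₁ u × (E₂ v × F₂ v))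
  LiftJoin-++ {u} (u′ , v′ , eq , cases) with ++-injective u u′ eq
  ... | refl , refl = cases

  LiftJoin-ι₁ : (u : Vtr n₁) → E (ι₁ u) ⇔ E₁ u
  LiftJoin-ι₁ u = mk⇔ head (λ u∈E₁ → u , 𝟎 , refl , inj₁ (u∈E₁ , refl))
    where
    head : E (ι₁ u) → E₁ u
    head u++𝟎∈E with LiftJoin-++ u++𝟎∈E
    ... | inj₁ (u∈E₁ , _)         = u∈E₁
    ... | inj₂ (inj₁ (_ , 𝟎∈E₂))  = ⊥-elim (matroid₂ 𝟎 𝟎∈E₂ refl)
    ... | inj₂ (inj₂ (_ , 𝟎∈E₂ , _)) = ⊥-elim (matroid₂ 𝟎 𝟎∈E₂ refl)

  LiftJoin-ι₂ : ¬ F₁ 𝟎 → (v : Vtr n₂) → E (ι₂ v) ⇔ E₂ v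
  LiftJoin-ι₂ 𝟎∉F₁ v = mk⇔ tail (λ v∈E₂ → 𝟎 , v , refl , inj₂ (inj₁ (refl , v∈E₂)))
    where
    tail : E (ι₂ v) → E₂ v
    tail 𝟎++v∈E with LiftJoin-++ 𝟎++v∈E
    ... | inj₁ (𝟎∈E₁ , _)         = ⊥-elim (matroid₁ 𝟎 𝟎∈E₁ refl)
    ... | inj₂ (inj₁ (_ , v∈E₂))  = v∈E₂
    ... | inj₂ (inj₂ (𝟎∈F₁ , _))  = ⊥-elim (𝟎∉F₁ 𝟎∈F₁)

  LiftJoin-isMatroid : IsMatroid (n₁ + n₂) E
  LiftJoin-isMatroid w w∈E refl =
    matroid₁ 𝟎 (to (LiftJoin-ι₁ 𝟎) (subst E (sym (𝟎++𝟎 n₁)) w∈E)) refl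

  LiftJoin-tail : {u : Vtr n₁} {v : Vtr n₂} → E (u ++ v) → v ≢ 𝟎 → E₂ v
  LiftJoin-tail u++v∈E v≢𝟎 with LiftJoin-++ u++v∈E
  ... | inj₁ (_ , v≡𝟎)           = ⊥-elim (v≢𝟎 v≡𝟎)
  ... | inj₂ (inj₁ (_ , v∈E₂))   = v∈E₂
  ... | inj₂ (inj₂ (_ , v∈E₂ , _)) = v∈E₂

  LiftJoin-fibre : {u : Vtr n₁} {v : Vtr n₂} → (F₁ ∪𝟎) u → E₂ v → F₂ v → E (u ++ v)
  LiftJoin-fibre (inj₁ u∈F₁) v∈E₂ v∈F₂ = _ , _ , refl , inj₂ (inj₂ (u∈F₁ , v∈E₂ , v∈F₂))
  LiftJoin-fibre (inj₂ refl) v∈E₂ _    = _ , _ , refl , inj₂ (inj₁ (refl , v∈E₂))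

  HasFlatOfDim-split : HasFlatOfDim (n₁ + n₂) E d →
                       ∃ λ k → ∃ λ p → k + p ≡ d × HasFlatOfDim n₁ E₁ k × HasFlatOfDim n₂ E₂ p
  HasFlatOfDim-split (W , _ , W⊆E , bs , basis) =
    nullity , rank , nullity+rank ,
    LinIndep⇒HasFlatOfDim heads-indep heads-span⊆E₁ ,
    LinIndep⇒HasFlatOfDim image-indep tails-span⊆E₂
    where
    open KernelImageSplit (kernelImageSplit (drop-linear {n₁}) bs (proj₁ basis))
    span⊆E : NonzeroSpan bs ⊆ E
    span⊆E = basis-NonzeroSpan-⊆ W⊆E basis
    heads : Vec (Vtr n₁) nullity
    heads = map (take n₁) kernelBasis
    kernel≡ι₁ : ∀ c → lincomb c kernelBasis ≡ ι₁ (lincomb c heads)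
    kernel≡ι₁ c = begin
      lincomb c kernelBasis                                      ≡⟨ sym (take++drop≡id n₁ _) ⟩
      take n₁ (lincomb c kernelBasis) ++ drop n₁ (lincomb c kernelBasis)
        ≡⟨ cong₂ _++_ (sym (lincomb-map take-linear c kernelBasis)) (kernelBasis-⊆ker c) ⟩
      ι₁ (lincomb c heads)                                       ∎
      where open ≡-Reasoning
    heads-indep : LinIndep heads
    heads-indep c null = kernelBasis-indep c (trans (kernel≡ι₁ c) (trans (cong ι₁ null) (𝟎++𝟎 n₁)))
    heads-span⊆E₁ : NonzeroSpan heads ⊆ E₁
    heads-span⊆E₁ _ ((c , refl) , v≢𝟎) =
      to (LiftJoin-ι₁ _) (subst E (kernel≡ι₁ c) (span⊆E _ (kernelBasis-⊆Span c , x≢𝟎)))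
      where
      x≢𝟎 : lincomb c kernelBasis ≢ 𝟎
      x≢𝟎 x≡𝟎 = v≢𝟎 (linear-injective-𝟎 ι₁-linear ι₁-injective _ (trans (sym (kernel≡ι₁ c)) x≡𝟎))
    tails-span⊆E₂ : NonzeroSpan (map (drop n₁) imageLift) ⊆ E₂
    tails-span⊆E₂ _ ((c , refl) , v≢𝟎) = subst E₂ (sym (lincomb-map drop-linear c imageLift))
      (LiftJoin-tail (subst E (sym (take++drop≡id n₁ x)) (span⊆E x (imageLift-⊆Span c , x≢𝟎))) dropx≢𝟎)
      where
      x : Vtr (n₁ + n₂)
      x = lincomb c imageLift
      dropx≢𝟎 : drop n₁ x ≢ 𝟎
      dropx≢𝟎 = subst (_≢ 𝟎) (lincomb-map drop-linear c imageLift) v≢𝟎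
      x≢𝟎 : x ≢ 𝟎
      x≢𝟎 x≡𝟎 = dropx≢𝟎 (trans (cong (drop n₁) x≡𝟎) (linear-𝟎 (drop-linear {n₁})))

  record Partition (bs : Vec (Vtr (n₁ + n₂)) d) : Set where
    field
      a b e : ℕ
      sizes : a + b + e ≡ d
      A     : Vec (Vtr n₁) a
      B     : Vec (Vtr n₂) b
      Dˡ    : Vec (Vtr n₁) e
      Dʳ    : Vec (Vtr n₂) e
      A⊑    : map ι₁ A ⊑ bs
      B⊑    : map ι₂ B ⊑ bs
      D⊑    : zipWith _++_ Dˡ Dʳ ⊑ bs
      Dˡ⊆F₁ : All F₁ Dˡ
      Dʳ⊆E₂ : All E₂ Dʳ
      Dʳ⊆F₂ : All F₂ Dʳ

  Partition-∷ : {w : Vtr (n₁ + n₂)} {ws : Vec (Vtr (n₁ + n₂)) d} →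
                E w → Partition ws → Partition (w ∷ ws)
  Partition-∷ (u , v , refl , inj₁ (_ , refl)) P = record
    { a = suc a ; b = b ; e = e ; sizes = cong suc sizes
    ; A = u ∷ A ; B = B ; Dˡ = Dˡ ; Dʳ = Dʳ
    ; A⊑ = keep A⊑ ; B⊑ = skip B⊑ ; D⊑ = skip D⊑
    ; Dˡ⊆F₁ = Dˡ⊆F₁ ; Dʳ⊆E₂ = Dʳ⊆E₂ ; Dʳ⊆F₂ = Dʳ⊆F₂ }
    where open Partition P
  Partition-∷ (u , v , refl , inj₂ (inj₁ (refl , _))) P = record
    { a = a ; b = suc b ; e = e ; sizes = trans (cong (_+ e) (+-suc a b)) (cong suc sizes)
    ; A = A ; B = v ∷ B ; Dˡ = Dˡ ; Dʳ = Dʳ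
    ; A⊑ = skip A⊑ ; B⊑ = keep B⊑ ; D⊑ = skip D⊑
    ; Dˡ⊆F₁ = Dˡ⊆F₁ ; Dʳ⊆E₂ = Dʳ⊆E₂ ; Dʳ⊆F₂ = Dʳ⊆F₂ }
    where open Partition P
  Partition-∷ (u , v , refl , inj₂ (inj₂ (u∈F₁ , v∈E₂ , v∈F₂))) P = record
    { a = a ; b = b ; e = suc e ; sizes = trans (+-suc (a + b) e) (cong suc sizes)
    ; A = A ; B = B ; Dˡ = u ∷ Dˡ ; Dʳ = v ∷ Dʳ
    ; A⊑ = skip A⊑ ; B⊑ = skip B⊑ ; D⊑ = keep D⊑
    ; Dˡ⊆F₁ = u∈F₁ ∷ Dˡ⊆F₁ ; Dʳ⊆E₂ = v∈E₂ ∷ Dʳ⊆E₂ ; Dʳ⊆F₂ = v∈F₂ ∷ Dʳ⊆F₂ }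
    where open Partition P

  partition : {bs : Vec (Vtr (n₁ + n₂)) d} → All E bs → Partition bs
  partition []           = record
    { a = 0 ; b = 0 ; e = 0 ; sizes = refl ; A = [] ; B = [] ; Dˡ = [] ; Dʳ = []
    ; A⊑ = [] ; B⊑ = [] ; D⊑ = [] ; Dˡ⊆F₁ = [] ; Dʳ⊆E₂ = [] ; Dʳ⊆F₂ = [] }
  partition (w∈E ∷ ws∈E) = Partition-∷ w∈E (partition ws∈E)

  HasIRestr-split : IsFlat n₁ F₁ → IsFlat n₂ F₂ → HasIRestr (n₁ + n₂) E d →
                    ∃ λ a → ∃ λ b → ∃ λ e → a + b + e ≡ d ×
                      HasIRestr n₁ E₁ a × HasIRestr n₂ E₂ b ×
                      (HasIRestr n₂ E₂ e ⊎ (e ≤ 2 × HasIRestr n₂ E₂ 1))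
  HasIRestr-split flat₁ flat₂ restr with HasIRestr⇒IsIFamily LiftJoin-isMatroid restr
  ... | bs , family =
    a , b , e , sizes ,
    IsIFamily⇒HasIRestr
      (to (IsIFamily-map ι₁-linear ι₁-injective LiftJoin-ι₁ A) (IsIFamily-⊑ A⊑ family)) ,
    IsIFamily⇒HasIRestr
      (to (IsIFamily-map ι₂-linear ι₂-injective (LiftJoin-ι₂ 𝟎∉F₁) B) (IsIFamily-⊑ B⊑ family)) ,
    MeetsSpanInUnits⇒HasIRestr⊎≤2 (meetsSpanInUnits {E = E₂} {Dʳ} Dʳ-meets)
    where
    open Partition (partition (MeetsSpanInUnits⇒All (IsIFamily.meets family)))
    𝟎∉F₁ : ¬ F₁ 𝟎
    𝟎∉F₁ 𝟎∈F₁ = proj₁ flat₁ 𝟎 𝟎∈F₁ refl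
    D-meets : MeetsSpanInUnits E (zipWith _++_ Dˡ Dʳ)
    D-meets = IsIFamily.meets (IsIFamily-⊑ D⊑ family)
    -- A combination of the tails lying in E₂ is, with its head in F₁ ∪ 0, a member of E.
    Dʳ-meets : ∀ c → E₂ (lincomb c Dʳ) ⇔ IsUnit c
    Dʳ-meets c = mk⇔ unit member
      where
      unit : E₂ (lincomb c Dʳ) → IsUnit c
      unit v∈E₂ with IsFlat-lincomb flat₂ Dʳ⊆F₂ c
      ... | inj₂ v≡𝟎 = ⊥-elim (matroid₂ _ v∈E₂ v≡𝟎)
      ... | inj₁ v∈F₂ = to (∈⇔IsUnit D-meets c)
        (subst E (sym (lincomb-++ c Dˡ Dʳ)) (LiftJoin-fibre (IsFlat-lincomb flat₁ Dˡ⊆F₁ c) v∈E₂ v∈F₂))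
      member : IsUnit c → E₂ (lincomb c Dʳ)
      member c-unit = All.lookup Dʳ⊆E₂ (lincomb-unit-∈ Dʳ c c-unit)

s+2≤3⊔2s : ∀ s → 1 ≤ s → s + 2 ≤ 3 ⊔ 2 * s
s+2≤3⊔2s (suc zero)    _ = ≤-refl
s+2≤3⊔2s (suc (suc s)) _ = ≤-trans (s≤s (s≤s (+-monoʳ-≤ s (s≤s (s≤s z≤n))))) (m≤n⊔m 3 _)

≤3⊔2* : {a b e σ₁ σ₂ : ℕ} → a ≤ σ₁ → b ≤ σ₂ → e ≤ σ₂ ⊎ (e ≤ 2 × 1 ≤ σ₂) →
        a + b + e ≤ 3 ⊔ 2 * (σ₁ + σ₂)
≤3⊔2* {σ₁ = σ₁} {σ₂} a≤ b≤ (inj₁ e≤σ₂) = begin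
  _                       ≤⟨ +-mono-≤ (+-mono-≤ a≤ b≤) e≤σ₂ ⟩
  (σ₁ + σ₂) + σ₂          ≤⟨ +-monoʳ-≤ (σ₁ + σ₂) (≤-trans (m≤n+m σ₂ σ₁) (m≤m+n _ 0)) ⟩
  2 * (σ₁ + σ₂)           ≤⟨ m≤n⊔m 3 _ ⟩
  3 ⊔ 2 * (σ₁ + σ₂)       ∎
  where open ≤-Reasoning
≤3⊔2* {σ₁ = σ₁} {σ₂} a≤ b≤ (inj₂ (e≤2 , 1≤σ₂)) =
  ≤-trans (+-mono-≤ (+-mono-≤ a≤ b≤) e≤2) (s+2≤3⊔2s (σ₁ + σ₂) (≤-trans 1≤σ₂ (m≤n+m σ₂ σ₁)))

lemma2p8 : ∀ (n₁ n₂ : ℕ) (E₁ F₁ : VSet n₁) (E₂ F₂ : VSet n₂)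
    → IsMatroid n₁ E₁ → IsMatroid n₂ E₂
    → IsFlat n₁ F₁ → IsFlat n₂ F₂
    → (∀ ω₁ ω₂ ω → IsOmega n₁ E₁ ω₁ → IsOmega n₂ E₂ ω₂
         → IsOmega (n₁ + n₂) (LiftJoin E₁ E₂ F₁ F₂) ω → ω ≤ ω₁ + ω₂)
    × (∀ σ₁ σ₂ σ → IsSigma n₁ E₁ σ₁ → IsSigma n₂ E₂ σ₂
         → IsSigma (n₁ + n₂) (LiftJoin E₁ E₂ F₁ F₂) σ → σ ≤ 3 ⊔ (2 * (σ₁ + σ₂)))
lemma2p8 n₁ n₂ E₁ F₁ E₂ F₂ matroid₁ matroid₂ flat₁ flat₂ = ω-bound , σ-bound
  where
  open LiftJoinProperties matroid₁ matroid₂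
  ω-bound : ∀ ω₁ ω₂ ω → IsOmega n₁ E₁ ω₁ → IsOmega n₂ E₂ ω₂ → IsOmega (n₁ + n₂) E ω → ω ≤ ω₁ + ω₂
  ω-bound ω₁ ω₂ _ (_ , ω₁-max) (_ , ω₂-max) (W , _) =
    let k , p , k+p≡ω , W₁ , W₂ = HasFlatOfDim-split W
    in subst (_≤ ω₁ + ω₂) k+p≡ω (+-mono-≤ (ω₁-max k W₁) (ω₂-max p W₂))
  σ-bound : ∀ σ₁ σ₂ σ → IsSigma n₁ E₁ σ₁ → IsSigma n₂ E₂ σ₂ → IsSigma (n₁ + n₂) E σ →
            σ ≤ 3 ⊔ (2 * (σ₁ + σ₂))
  σ-bound σ₁ σ₂ _ (_ , σ₁-max) (_ , σ₂-max) (I , _) =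
    let a , b , e , a+b+e≡σ , Iᴬ , Iᴮ , Iᴰ = HasIRestr-split flat₁ flat₂ I
    in subst (_≤ 3 ⊔ (2 * (σ₁ + σ₂))) a+b+e≡σ
         (≤3⊔2* (σ₁-max a Iᴬ) (σ₂-max b Iᴮ) (Sum.map (σ₂-max e) (map₂ (σ₂-max 1)) Iᴰ))
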